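{- For every integer $m\ge2$, $G_{m,m-1}(q)=2G_{m,m-2}(q)$ and $H_{m,m-1}(q)=2H_{m,m-2}(q)$.
   Context: $q$ is an indeterminate (with square root $q^{1/2}$), $[k]=\frac{1-q^k}{1-q}$. For integers $m\ge1$, $n\geq1$ let $T_{m,n}(q)=\sum_{k=1}^n(-1)^{n-k}[k]^mq^{\frac m2(n-k)}$. The polynomials $G_{m,j}(q)\in\mathbb Z[q]$ and $H_{m,j}(x)\in\mathbb Z[x]$ ($m\ge1$, $0\le j\le m-1$) are the (existing, uniquely determined) polynomials such that for all integers $n\ge1$: $T_{2m,n}(q)=\sum_{k=1}^m(-q^n)^{m-k}\frac{G_{m,m-k}(q)}{\prod_{i=0}^{m-k}(1+q^{m-i})}([n][n+1])^k$ and $T_{2m-1,n}(q)=(-1)^{m+n}H_{m,m-1}(q^{\frac12})\frac{q^{(m-\frac12)n}}{(1+q^{\frac12})^m\prod_{i=0}^{m-1}(1+q^{m-i-\frac12})}+\frac{1-q^{n+\frac12}}{1-q^{\frac12}}\sum_{k=1}^m(-q^n)^{m-k}\frac{H_{m,m-k}(q^{\frac12})([n][n+1])^{k-1}}{(1+q^{\frac12})^{m-k+1}\prod_{i=0}^{m-k}(1+q^{m-i-\frac12})}$. -}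

module Defs where

open import Data.Nat as ℕ using (ℕ; zero; suc; _∸_; _≤_)
open import Data.Integer as ℤ using (ℤ; +_; +[1+_]; -[1+_])
open import Data.Rational using (ℚ; mkℚ; _/_; 0ℚ; 1ℚ; _+_; _*_; _-_; -_; _÷_)
open import Data.List using (List; []; _∷_; map)
open import Data.Product using (_×_)
open import Relation.Binary.PropositionalEquality using (_≡_; _≢_)

ι : ℤ → ℚ
ι i = i / 1

infixr 8 _^_
_^_ : ℚ → ℕ → ℚ
x ^ zero  = 1ℚ
x ^ suc k = x * (x ^ k)

-- total division on ℚ (x / 0 := 0); only ever used at points where the
-- divisor is nonzero (guaranteed by the hypotheses of the statement)
infixl 7 _÷′_
_÷′_ : ℚ → ℚ → ℚ
p ÷′ mkℚ (+ zero)  _ _ = 0ℚ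
p ÷′ q@(mkℚ +[1+ _ ] _ _) = p ÷ q
p ÷′ q@(mkℚ -[1+ _ ] _ _) = p ÷ q

Σ₁ : ℕ → (ℕ → ℚ) → ℚ
Σ₁ zero    f = 0ℚ
Σ₁ (suc n) f = Σ₁ n f + f (suc n)

Π₀ : ℕ → (ℕ → ℚ) → ℚ
Π₀ zero    f = f zero
Π₀ (suc N) f = Π₀ N f * f (suc N)

sgn : ℕ → ℚ
sgn k = (- 1ℚ) ^ k

-- Polynomials with integer coefficients (coefficient lists, constant
-- term first); equality is coefficientwise (trailing zeros irrelevant)

Poly : Set
Poly = List ℤ

coeff : Poly → ℕ → ℤ
coeff []       _       = + 0
coeff (a ∷ p)  zero    = a
coeff (a ∷ p)  (suc d) = coeff p d

_≈ₚ_ : Poly → Poly → Set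
p ≈ₚ r = ∀ d → coeff p d ≡ coeff r d

twice : Poly → Poly
twice p = map (ℤ._*_ (+ 2)) p

eval : Poly → ℚ → ℚ
eval []      x = 0ℚ
eval (a ∷ p) x = ι a + x * eval p x

-- q-integers and T_{M,n}; everything is expressed in t = q^{1/2}, q = t²

qint : ℚ → ℕ → ℚ
qint q k = (1ℚ - q ^ k) ÷′ (1ℚ - q)

-- T_{M,n}(q) = Σ_{k=1}^n (-1)^{n-k} [k]^M q^{(M/2)(n-k)},  with q^{1/2} = t
T : ℕ → ℕ → ℚ → ℚ
T M n t = Σ₁ n (λ k → sgn (n ∸ k) * (qint (t * t) k ^ M) * (t ^ (M ℕ.* (n ∸ k))))

-- T_{2m,n}(q) = Σ_{k=1}^m (-q^n)^{m-k} G_{m,m-k}(q)/∏_{i=0}^{m-k}(1+q^{m-i}) ([n][n+1])^k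
IsGFamily : (ℕ → ℕ → Poly) → Set
IsGFamily G =
  ∀ m → 1 ≤ m → ∀ n → 1 ≤ n → ∀ (t : ℚ) → t ≢ 1ℚ → t ≢ - 1ℚ →
    let q = t * t in
    T (2 ℕ.* m) n t ≡
      Σ₁ m (λ k → ((- (q ^ n)) ^ (m ∸ k))
                  * (eval (G m (m ∸ k)) q ÷′ Π₀ (m ∸ k) (λ i → 1ℚ + q ^ (m ∸ i)))
                  * ((qint q n * qint q (suc n)) ^ k))

-- T_{2m-1,n}(q) = (-1)^{m+n} H_{m,m-1}(q^{1/2}) q^{(m-1/2)n}
--                   / ((1+q^{1/2})^m ∏_{i=0}^{m-1}(1+q^{m-i-1/2}))
--   + (1-q^{n+1/2})/(1-q^{1/2}) Σ_{k=1}^m (-q^n)^{m-k} H_{m,m-k}(q^{1/2}) ([n][n+1])^{k-1}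
--                   / ((1+q^{1/2})^{m-k+1} ∏_{i=0}^{m-k}(1+q^{m-i-1/2}))
IsHFamily : (ℕ → ℕ → Poly) → Set
IsHFamily H =
  ∀ m → 1 ≤ m → ∀ n → 1 ≤ n → ∀ (t : ℚ) → t ≢ 1ℚ → t ≢ - 1ℚ →
    let q = t * t in
    T (2 ℕ.* m ∸ 1) n t ≡
      sgn (m ℕ.+ n) * (eval (H m (m ∸ 1)) t * t ^ ((2 ℕ.* m ∸ 1) ℕ.* n))
        ÷′ (((1ℚ + t) ^ m) * Π₀ (m ∸ 1) (λ i → 1ℚ + t ^ (2 ℕ.* (m ∸ i) ∸ 1)))
      + ((1ℚ - t ^ (2 ℕ.* n ℕ.+ 1)) ÷′ (1ℚ - t))
        * Σ₁ m (λ k → ((- (q ^ n)) ^ (m ∸ k)) * eval (H m (m ∸ k)) t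
                      * ((qint q n * qint q (suc n)) ^ (k ∸ 1))
                      ÷′ (((1ℚ + t) ^ (m ∸ k ℕ.+ 1))
                          * Π₀ (m ∸ k) (λ i → 1ℚ + t ^ (2 ℕ.* (m ∸ i) ∸ 1))))

{-# OPTIONS --safe #-}
-- Put x = qⁿ, so that [n] = X x and [n+1] = Y x with X x = (1-x)/(1-q) and Y x = (1-qx)/(1-q).
-- The defining identities write T_{2m,n} as X x Y x S(x) and T_{2m-1,n} as a geometric term plus
-- (1-q^{1/2}x)/(1-q^{1/2}) S(x), where S(x) = Σ_k (-x)^{m-k} c_{m-k} (X x Y x)^{k-1} is a polynomial
-- in x and c_j is G_{m,j}(q) (resp. H_{m,j}(q^{1/2})) divided by its denominator.  The recurrence
-- T_{M,n+1} + q^{M/2} T_{M,n} = [n+1]^M turns either identity (for G after cancelling a factor Y(x))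
-- into α(x) S(qx) + q^{m-1} β(x) S(x) = Y(x)^{2m-1} at all x = qⁿ, with α, β polynomials.  Its defect is
-- Y(x) times a polynomial Φ vanishing at all qⁿ, hence everywhere.  At x = 1/q both X x Y x and
-- X(qx) Y(qx) vanish, so Φ(1/q) = 0 only involves the top coefficients and reads
-- κ c_{m-1} = 2 c_{m-2} with κ = 1 + q (resp. (1 + q^{1/2})²), which is exactly the ratio of the
-- denominators.  So G_{m,m-1}(q) = 2 G_{m,m-2}(q) for infinitely many q, hence as polynomials, and
-- likewise for H.

module Submission where

open import Defs
open import Data.Nat using (ℕ; _≤_; _∸_)
open import Data.Product using (_×_)

open import Level using (0ℓ)
open import Data.Empty using (⊥-elim)
open import Data.Maybe using (Maybe)
open import Relation.Nullary.Decidable using (dec⇒maybe)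
open import Data.Nat as ℕ using (zero; suc; s≤s; z≤n)
import Data.Nat.Properties as ℕ
open import Data.Integer as ℤ using (+0; -[1+_]; +[1+_])
open import Data.Rational
  using (ℚ; mkℚ; ↥_; 0ℚ; 1ℚ; _+_; _*_; _-_; -_; 1/_; _<_; NonZero; Positive; ≢-nonZero; positive; *<*)
open import Data.Rational.Properties
open import Data.Product using (∃; ∃₂; _,_; proj₁; proj₂)
open import Data.Sum using (inj₁; inj₂)
open import Data.List using (_∷_; []; drop)
import Data.Nat.Coprimality as Coprime
open import Relation.Binary.Definitions using (tri<; tri≈; tri>)
open import Function.Definitions using (Injective)
open import Relation.Binary.PropositionalEquality
open import Algebra.Properties.Group +-0-group using (inverseˡ-unique)
  renaming (x∙y⁻¹≈ε⇒x≈y to x-y≡0⇒x≡y; ∙-cancelˡ to +-cancelˡ)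
open import Tactic.RingSolver using (solve-∀)
import Data.Nat.Tactic.RingSolver as ℕSolver
open import Tactic.RingSolver.Core.AlmostCommutativeRing using (AlmostCommutativeRing; fromCommutativeRing)

-- Arithmetic in ℚ

ℚ-ring : AlmostCommutativeRing 0ℓ 0ℓ
ℚ-ring = fromCommutativeRing +-*-commutativeRing isZero
  where
  isZero : ∀ x → Maybe (0ℚ ≡ x)
  isZero x = dec⇒maybe (0ℚ ≟ x)

1÷′≡1/ : ∀ d {{_ : NonZero d}} → 1ℚ ÷′ d ≡ 1/ d
1÷′≡1/ (mkℚ +0 _ _) {{d≢0}} = ⊥-elim (ℕ.NonZero.nonZero d≢0)
1÷′≡1/ d@(mkℚ +[1+ _ ] _ _) = *-identityˡ (1/ d)
1÷′≡1/ d@(mkℚ -[1+ _ ] _ _) = *-identityˡ (1/ d)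

÷′≡*1÷′ : ∀ p d → p ÷′ d ≡ p * (1ℚ ÷′ d)
÷′≡*1÷′ p (mkℚ +0 _ _)  = sym (*-zeroʳ p)
÷′≡*1÷′ p d@(mkℚ +[1+ _ ] _ _) = cong (p *_) (sym (1÷′≡1/ d))
÷′≡*1÷′ p d@(mkℚ -[1+ _ ] _ _) = cong (p *_) (sym (1÷′≡1/ d))

*-1÷′-inverse : ∀ {d} → d ≢ 0ℚ → d * (1ℚ ÷′ d) ≡ 1ℚ
*-1÷′-inverse {d} d≢0 = trans (cong (d *_) (1÷′≡1/ d)) (*-inverseʳ d)
  where instance _ = ≢-nonZero d≢0

÷′-*-cancel : ∀ p {d} → d ≢ 0ℚ → (p ÷′ d) * d ≡ p
÷′-*-cancel p {d} d≢0 = begin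
  p ÷′ d * d                ≡⟨ cong (_* d) (÷′≡*1÷′ p d) ⟩
  p * (1ℚ ÷′ d) * d         ≡⟨ rearrange p d (1ℚ ÷′ d) ⟩
  p * (d * (1ℚ ÷′ d))       ≡⟨ cong (p *_) (*-1÷′-inverse d≢0) ⟩
  p * 1ℚ                    ≡⟨ *-identityʳ p ⟩
  p                         ∎
  where
  open ≡-Reasoning
  rearrange : ∀ p d i → p * i * d ≡ p * (d * i)
  rearrange = solve-∀ ℚ-ring

*-cancelˡ-≢0 : ∀ {p a b} → p ≢ 0ℚ → p * a ≡ p * b → a ≡ b
*-cancelˡ-≢0 {p} {a} {b} p≢0 eq = begin
  a                    ≡⟨ sym (÷′-*-cancel a p≢0) ⟩
  a ÷′ p * p           ≡⟨ cong (_* p) (÷′≡*1÷′ a p) ⟩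
  a * (1ℚ ÷′ p) * p    ≡⟨ rearrange a p (1ℚ ÷′ p) ⟩
  (p * a) * (1ℚ ÷′ p)  ≡⟨ cong (_* (1ℚ ÷′ p)) eq ⟩
  (p * b) * (1ℚ ÷′ p)  ≡⟨ sym (rearrange b p (1ℚ ÷′ p)) ⟩
  b * (1ℚ ÷′ p) * p    ≡⟨ cong (_* p) (sym (÷′≡*1÷′ b p)) ⟩
  b ÷′ p * p           ≡⟨ ÷′-*-cancel b p≢0 ⟩
  b                    ∎
  where
  open ≡-Reasoning
  rearrange : ∀ a p i → a * i * p ≡ (p * a) * i
  rearrange = solve-∀ ℚ-ring

*-≡0-cancelˡ : ∀ {p a} → p ≢ 0ℚ → p * a ≡ 0ℚ → a ≡ 0ℚ
*-≡0-cancelˡ {p} p≢0 eq = *-cancelˡ-≢0 p≢0 (trans eq (sym (*-zeroʳ p)))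

*-≢0 : ∀ {p a} → p ≢ 0ℚ → a ≢ 0ℚ → p * a ≢ 0ℚ
*-≢0 p≢0 a≢0 pa≡0 = a≢0 (*-≡0-cancelˡ p≢0 pa≡0)

inverse-≢0 : ∀ {p i} → p * i ≡ 1ℚ → i ≢ 0ℚ
inverse-≢0 {p} {i} pi≡1 i≡0 = 1≢0 (trans (sym pi≡1) (trans (cong (p *_) i≡0) (*-zeroʳ p)))

1-≢0 : ∀ {a} → a ≢ 1ℚ → 1ℚ - a ≢ 0ℚ
1-≢0 a≢1 eq = a≢1 (sym (x-y≡0⇒x≡y 1ℚ _ eq))

cancel-denominators : ∀ {a b D} k d e → d ≢ 0ℚ → e ≢ 0ℚ → D ≡ d * e →
                      e * (a ÷′ D) ≡ k * (b ÷′ d) → a ≡ k * b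
cancel-denominators {a} {b} {D} k d e d≢0 e≢0 D≡de eq = begin
  a                      ≡⟨ sym (÷′-*-cancel a D≢0) ⟩
  a ÷′ D * D             ≡⟨ cong (a ÷′ D *_) D≡de ⟩
  a ÷′ D * (d * e)       ≡⟨ regroup (a ÷′ D) d e ⟩
  e * (a ÷′ D) * d       ≡⟨ cong (_* d) eq ⟩
  k * (b ÷′ d) * d       ≡⟨ *-assoc k (b ÷′ d) d ⟩
  k * (b ÷′ d * d)       ≡⟨ cong (k *_) (÷′-*-cancel b d≢0) ⟩
  k * b                  ∎
  where
  open ≡-Reasoning
  D≢0 : D ≢ 0ℚ
  D≢0 = subst (_≢ 0ℚ) (sym D≡de) (*-≢0 d≢0 e≢0)
  regroup : ∀ x d e → x * (d * e) ≡ e * x * d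
  regroup = solve-∀ ℚ-ring

^-distribˡ-+-* : ∀ x a b → x ^ (a ℕ.+ b) ≡ x ^ a * x ^ b
^-distribˡ-+-* x zero    b = sym (*-identityˡ (x ^ b))
^-distribˡ-+-* x (suc a) b = trans (cong (x *_) (^-distribˡ-+-* x a b)) (sym (*-assoc x _ _))

^-distribʳ-* : ∀ x y k → (x * y) ^ k ≡ x ^ k * y ^ k
^-distribʳ-* x y zero    = sym (*-identityˡ 1ℚ)
^-distribʳ-* x y (suc k) = trans (cong (x * y *_) (^-distribʳ-* x y k)) (interchange x y (x ^ k) (y ^ k))
  where
  interchange : ∀ a b c d → a * b * (c * d) ≡ a * c * (b * d)
  interchange = solve-∀ ℚ-ring

^-even : ∀ t k → t ^ (2 ℕ.* k) ≡ (t * t) ^ k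
^-even t k = begin
  t ^ (k ℕ.+ (k ℕ.+ 0)) ≡⟨ cong (λ e → t ^ (k ℕ.+ e)) (ℕ.+-identityʳ k) ⟩
  t ^ (k ℕ.+ k)         ≡⟨ ^-distribˡ-+-* t k k ⟩
  t ^ k * t ^ k         ≡⟨ sym (^-distribʳ-* t t k) ⟩
  (t * t) ^ k           ∎
  where open ≡-Reasoning

^-odd : ∀ t k → t ^ (2 ℕ.* k ℕ.+ 1) ≡ t * (t * t) ^ k
^-odd t k = begin
  t ^ (2 ℕ.* k ℕ.+ 1)   ≡⟨ cong (t ^_) (ℕ.+-comm (2 ℕ.* k) 1) ⟩
  t * t ^ (2 ℕ.* k)     ≡⟨ cong (t *_) (^-even t k) ⟩
  t * (t * t) ^ k       ∎
  where open ≡-Reasoning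

neg-*-^ : ∀ a b k → (- (a * b)) ^ k ≡ a ^ k * (- b) ^ k
neg-*-^ a b k = trans (cong (_^ k) (neg-distribʳ-* a b)) (^-distribʳ-* a (- b) k)

0^suc : ∀ k → 0ℚ ^ suc k ≡ 0ℚ
0^suc k = *-zeroˡ (0ℚ ^ k)

sgn-self-inverse : ∀ k → sgn k * sgn k ≡ 1ℚ
sgn-self-inverse zero    = refl
sgn-self-inverse (suc k) = trans (regroup (sgn k)) (sgn-self-inverse k)
  where
  regroup : ∀ s → (- 1ℚ) * s * ((- 1ℚ) * s) ≡ s * s
  regroup = solve-∀ ℚ-ring

-- Finite sums and the recurrence of T

Σ₁-cong : ∀ n {f g : ℕ → ℚ} → (∀ k → 1 ≤ k → k ≤ n → f k ≡ g k) → Σ₁ n f ≡ Σ₁ n g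
Σ₁-cong zero    f≡g = refl
Σ₁-cong (suc n) f≡g =
  cong₂ _+_ (Σ₁-cong n (λ k 1≤k k≤n → f≡g k 1≤k (ℕ.m≤n⇒m≤1+n k≤n))) (f≡g (suc n) (s≤s z≤n) ℕ.≤-refl)

Σ₁-*ˡ : ∀ n a (f : ℕ → ℚ) → Σ₁ n (λ k → a * f k) ≡ a * Σ₁ n f
Σ₁-*ˡ zero    a f = sym (*-zeroʳ a)
Σ₁-*ˡ (suc n) a f = trans (cong (_+ a * f (suc n)) (Σ₁-*ˡ n a f)) (sym (*-distribˡ-+ a _ _))

Σ₁-unconsˡ : ∀ n (f : ℕ → ℚ) → Σ₁ (suc n) f ≡ f 1 + Σ₁ n (λ k → f (suc k))
Σ₁-unconsˡ zero    f = trans (+-identityˡ (f 1)) (sym (+-identityʳ (f 1)))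
Σ₁-unconsˡ (suc n) f = trans (cong (_+ f (suc (suc n))) (Σ₁-unconsˡ n f)) (+-assoc (f 1) _ _)

horner : (ℕ → ℚ) → ℚ → ℕ → ℚ
horner a U zero    = 0ℚ
horner a U (suc j) = a j + U * horner a U j

Σ₁-horner : ∀ m (a : ℕ → ℚ) U → Σ₁ m (λ k → a (m ∸ k) * U ^ (k ∸ 1)) ≡ horner a U m
Σ₁-horner zero    a U = refl
Σ₁-horner (suc m) a U = begin
  Σ₁ (suc m) (λ k → a (suc m ∸ k) * U ^ (k ∸ 1))
    ≡⟨ Σ₁-unconsˡ m _ ⟩
  a m * 1ℚ + Σ₁ m (λ k → a (m ∸ k) * U ^ k)
    ≡⟨ cong₂ _+_ (*-identityʳ (a m)) (Σ₁-cong m (λ { (suc k) _ _ → swap (a (m ∸ suc k)) U (U ^ k) })) ⟩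
  a m + Σ₁ m (λ k → U * (a (m ∸ k) * U ^ (k ∸ 1)))
    ≡⟨ cong (λ s → a m + s) (Σ₁-*ˡ m U _) ⟩
  a m + U * Σ₁ m (λ k → a (m ∸ k) * U ^ (k ∸ 1))
    ≡⟨ cong (λ s → a m + U * s) (Σ₁-horner m a U) ⟩
  a m + U * horner a U m
    ∎
  where
  open ≡-Reasoning
  swap : ∀ a U V → a * (U * V) ≡ U * (a * V)
  swap = solve-∀ ℚ-ring

Σ₁-horner-shifted : ∀ m (a : ℕ → ℚ) U → Σ₁ m (λ k → a (m ∸ k) * U ^ k) ≡ U * horner a U m
Σ₁-horner-shifted m a U = begin
  Σ₁ m (λ k → a (m ∸ k) * U ^ k)
    ≡⟨ Σ₁-cong m (λ { (suc k) _ _ → swap (a (m ∸ suc k)) U (U ^ k) }) ⟩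
  Σ₁ m (λ k → U * (a (m ∸ k) * U ^ (k ∸ 1)))
    ≡⟨ Σ₁-*ˡ m U _ ⟩
  U * Σ₁ m (λ k → a (m ∸ k) * U ^ (k ∸ 1))
    ≡⟨ cong (U *_) (Σ₁-horner m a U) ⟩
  U * horner a U m
    ∎
  where
  open ≡-Reasoning
  swap : ∀ a U V → a * (U * V) ≡ U * (a * V)
  swap = solve-∀ ℚ-ring

T-recurrence : ∀ M n t → T M (suc n) t + t ^ M * T M n t ≡ qint (t * t) (suc n) ^ M
T-recurrence M n t = begin
  Σ₁ n (term (suc n)) + term (suc n) (suc n) + t ^ M * Σ₁ n (term n)
    ≡⟨ cong₂ (λ s e → s + e + t ^ M * Σ₁ n (term n)) (Σ₁-cong n (λ k _ k≤n → term-step k≤n)) term-last ⟩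
  Σ₁ n (λ k → - (t ^ M) * term n k) + [n+1]^M + t ^ M * Σ₁ n (term n)
    ≡⟨ cong (λ s → s + [n+1]^M + t ^ M * Σ₁ n (term n)) (Σ₁-*ˡ n (- (t ^ M)) (term n)) ⟩
  - (t ^ M) * Σ₁ n (term n) + [n+1]^M + t ^ M * Σ₁ n (term n)
    ≡⟨ cancel (t ^ M) (Σ₁ n (term n)) [n+1]^M ⟩
  [n+1]^M
    ∎
  where
  open ≡-Reasoning
  term : ℕ → ℕ → ℚ
  term n k = sgn (n ∸ k) * (qint (t * t) k ^ M) * (t ^ (M ℕ.* (n ∸ k)))
  [n+1]^M : ℚ
  [n+1]^M = qint (t * t) (suc n) ^ M
  cancel : ∀ a s e → - a * s + e + a * s ≡ e
  cancel = solve-∀ ℚ-ring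
  term-step : ∀ {k} → k ≤ n → term (suc n) k ≡ - (t ^ M) * term n k
  term-step {k} k≤n = begin
    sgn (suc n ∸ k) * Q * t ^ (M ℕ.* (suc n ∸ k))
      ≡⟨ cong (λ e → sgn e * Q * t ^ (M ℕ.* e)) (ℕ.+-∸-assoc 1 k≤n) ⟩
    (- 1ℚ) * sgn (n ∸ k) * Q * t ^ (M ℕ.* suc (n ∸ k))
      ≡⟨ cong (λ e → (- 1ℚ) * sgn (n ∸ k) * Q * t ^ e) (ℕ.*-suc M (n ∸ k)) ⟩
    (- 1ℚ) * sgn (n ∸ k) * Q * t ^ (M ℕ.+ M ℕ.* (n ∸ k))
      ≡⟨ cong ((- 1ℚ) * sgn (n ∸ k) * Q *_) (^-distribˡ-+-* t M (M ℕ.* (n ∸ k))) ⟩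
    (- 1ℚ) * sgn (n ∸ k) * Q * (t ^ M * t ^ (M ℕ.* (n ∸ k)))
      ≡⟨ regroup (sgn (n ∸ k)) Q (t ^ M) (t ^ (M ℕ.* (n ∸ k))) ⟩
    - (t ^ M) * term n k
      ∎
    where
    Q : ℚ
    Q = qint (t * t) k ^ M
    regroup : ∀ s Q a p → (- 1ℚ) * s * Q * (a * p) ≡ - a * (s * Q * p)
    regroup = solve-∀ ℚ-ring
  term-last : term (suc n) (suc n) ≡ [n+1]^M
  term-last = begin
    sgn (n ∸ n) * [n+1]^M * t ^ (M ℕ.* (n ∸ n))
      ≡⟨ cong (λ e → sgn e * [n+1]^M * t ^ (M ℕ.* e)) (ℕ.n∸n≡0 n) ⟩
    1ℚ * [n+1]^M * t ^ (M ℕ.* 0)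
      ≡⟨ cong (λ e → 1ℚ * [n+1]^M * t ^ e) (ℕ.*-zeroʳ M) ⟩
    1ℚ * [n+1]^M * 1ℚ
      ≡⟨ trans (*-identityʳ _) (*-identityˡ [n+1]^M) ⟩
    [n+1]^M
      ∎

alternating-geometric-recurrence : ∀ t M a Δ k n →
  sgn (k ℕ.+ suc n) * (a * t ^ (M ℕ.* suc n)) ÷′ Δ + t ^ M * (sgn (k ℕ.+ n) * (a * t ^ (M ℕ.* n)) ÷′ Δ) ≡ 0ℚ
alternating-geometric-recurrence t M a Δ k n = begin
  sgn (k ℕ.+ suc n) * (a * t ^ (M ℕ.* suc n)) ÷′ Δ + t ^ M * (sgn (k ℕ.+ n) * (a * t ^ (M ℕ.* n)) ÷′ Δ)
    ≡⟨ cong₂ (λ x y → x + t ^ M * y) (÷′≡*1÷′ _ Δ) (÷′≡*1÷′ _ Δ) ⟩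
  sgn (k ℕ.+ suc n) * (a * t ^ (M ℕ.* suc n)) * i + t ^ M * (s * (a * p) * i)
    ≡⟨ cong₂ (λ e e′ → sgn e * (a * t ^ e′) * i + t ^ M * (s * (a * p) * i)) (ℕ.+-suc k n) (ℕ.*-suc M n) ⟩
  (- 1ℚ) * s * (a * t ^ (M ℕ.+ M ℕ.* n)) * i + t ^ M * (s * (a * p) * i)
    ≡⟨ cong (λ z → (- 1ℚ) * s * (a * z) * i + t ^ M * (s * (a * p) * i)) (^-distribˡ-+-* t M (M ℕ.* n)) ⟩
  (- 1ℚ) * s * (a * (t ^ M * p)) * i + t ^ M * (s * (a * p) * i)
    ≡⟨ cancel s a (t ^ M) p i ⟩
  0ℚ ∎
  where
  open ≡-Reasoning
  s p i : ℚ
  s = sgn (k ℕ.+ n)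
  p = t ^ (M ℕ.* n)
  i = 1ℚ ÷′ Δ
  cancel : ∀ s a b p i → (- 1ℚ) * s * (a * (b * p)) * i + b * (s * (a * p) * i) ≡ 0ℚ
  cancel = solve-∀ ℚ-ring

drop-homogeneous : ∀ h₁ h₀ F₁ F₀ a Q → h₁ + F₁ + a * (h₀ + F₀) ≡ Q → h₁ + a * h₀ ≡ 0ℚ →
                   F₁ + a * F₀ ≡ Q
drop-homogeneous h₁ h₀ F₁ F₀ a Q full≡Q hom≡0 = begin
  F₁ + a * F₀                                       ≡⟨ split h₁ h₀ F₁ F₀ a ⟩
  (h₁ + F₁ + a * (h₀ + F₀)) - (h₁ + a * h₀)         ≡⟨ cong₂ _-_ full≡Q hom≡0 ⟩
  Q - 0ℚ                                            ≡⟨ +-identityʳ Q ⟩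
  Q                                                 ∎
  where
  open ≡-Reasoning
  split : ∀ h₁ h₀ F₁ F₀ a → F₁ + a * F₀ ≡ (h₁ + F₁ + a * (h₀ + F₀)) - (h₁ + a * h₀)
  split = solve-∀ ℚ-ring

-- Polynomial functions

HasDegree< : ℕ → (ℚ → ℚ) → Set
HasDegree< zero    f = ∀ x → f x ≡ 0ℚ
HasDegree< (suc d) f = ∃₂ λ a g → HasDegree< d g × (∀ x → f x ≡ a + x * g x)

IsPolynomial : (ℚ → ℚ) → Set
IsPolynomial f = ∃ λ d → HasDegree< d f

HasDegree<-resp-≗ : ∀ {d f g} → f ≗ g → HasDegree< d f → HasDegree< d g
HasDegree<-resp-≗ {zero}  f≗g f≡0 x = trans (sym (f≗g x)) (f≡0 x)
HasDegree<-resp-≗ {suc d} f≗g (a , h , h-deg , f≡) = a , h , h-deg , λ x → trans (sym (f≗g x)) (f≡ x)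

HasDegree<-+ : ∀ {d e f g} → HasDegree< d f → HasDegree< e g → HasDegree< (d ℕ.⊔ e) (λ x → f x + g x)
HasDegree<-+ {zero} {_} {f} {g} f≡0 g-deg =
  HasDegree<-resp-≗ (λ x → sym (trans (cong (_+ g x) (f≡0 x)) (+-identityˡ (g x)))) g-deg
HasDegree<-+ {suc d} {zero} {f} {g} f-deg g≡0 =
  HasDegree<-resp-≗ (λ x → sym (trans (cong (f x +_) (g≡0 x)) (+-identityʳ (f x)))) f-deg
HasDegree<-+ {suc d} {suc e} (a , f′ , f′-deg , f≡) (b , g′ , g′-deg , g≡) =
  a + b , _ , HasDegree<-+ f′-deg g′-deg , λ x → trans (cong₂ _+_ (f≡ x) (g≡ x)) (regroup a b x (f′ x) (g′ x))
  where
  regroup : ∀ a b x f g → a + x * f + (b + x * g) ≡ a + b + x * (f + g)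
  regroup = solve-∀ ℚ-ring

HasDegree<-scale : ∀ {d f} c → HasDegree< d f → HasDegree< d (λ x → c * f x)
HasDegree<-scale {zero}  c f≡0 x = trans (cong (c *_) (f≡0 x)) (*-zeroʳ c)
HasDegree<-scale {suc d} c (a , f′ , f′-deg , f≡) =
  c * a , _ , HasDegree<-scale c f′-deg , λ x → trans (cong (c *_) (f≡ x)) (regroup c a x (f′ x))
  where
  regroup : ∀ c a x f → c * (a + x * f) ≡ c * a + x * (c * f)
  regroup = solve-∀ ℚ-ring

HasDegree<-∘-scale : ∀ {d f} c → HasDegree< d f → HasDegree< d (λ x → f (c * x))
HasDegree<-∘-scale {zero}  c f≡0 x = f≡0 (c * x)
HasDegree<-∘-scale {suc d} c (a , f′ , f′-deg , f≡) =
  a , _ , HasDegree<-scale c (HasDegree<-∘-scale c f′-deg) ,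
  λ x → trans (f≡ (c * x)) (cong (a +_) (regroup c x (f′ (c * x))))
  where
  regroup : ∀ c x f → c * x * f ≡ x * (c * f)
  regroup = solve-∀ ℚ-ring

poly-const : ∀ a → IsPolynomial (λ _ → a)
poly-const a = 1 , a , (λ _ → 0ℚ) , (λ _ → refl) , λ x → sym (trans (cong (a +_) (*-zeroʳ x)) (+-identityʳ a))

poly-id : IsPolynomial (λ x → x)
poly-id = 2 , 0ℚ , (λ _ → 1ℚ) , proj₂ (poly-const 1ℚ) , λ x → sym (trans (+-identityˡ _) (*-identityʳ x))

poly-+ : ∀ {f g} → IsPolynomial f → IsPolynomial g → IsPolynomial (λ x → f x + g x)
poly-+ (d , f-deg) (e , g-deg) = d ℕ.⊔ e , HasDegree<-+ f-deg g-deg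

poly-x* : ∀ {f} → IsPolynomial f → IsPolynomial (λ x → x * f x)
poly-x* (d , f-deg) = suc d , 0ℚ , _ , f-deg , λ x → sym (+-identityˡ _)

poly-* : ∀ {f g} → IsPolynomial f → IsPolynomial g → IsPolynomial (λ x → f x * g x)
poly-* {f} {g} (zero , f≡0) _ = 0 , λ x → trans (cong (_* g x) (f≡0 x)) (*-zeroˡ (g x))
poly-* {f} {g} (suc d , a , f′ , f′-deg , f≡) (e , g-deg) =
  (e ℕ.⊔ _) , HasDegree<-resp-≗ (λ x → sym (trans (cong (_* g x) (f≡ x)) (distrib a x (f′ x) (g x))))
                 (HasDegree<-+ (HasDegree<-scale a g-deg) (proj₂ (poly-x* (poly-* (d , f′-deg) (e , g-deg)))))
  where
  distrib : ∀ a x f g → (a + x * f) * g ≡ a * g + x * (f * g)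
  distrib = solve-∀ ℚ-ring

poly-neg : ∀ {f} → IsPolynomial f → IsPolynomial (λ x → - f x)
poly-neg {f} (d , f-deg) = d , HasDegree<-resp-≗ (λ x → neg-as-scale (f x)) (HasDegree<-scale (- 1ℚ) f-deg)
  where
  neg-as-scale : ∀ y → - 1ℚ * y ≡ - y
  neg-as-scale = solve-∀ ℚ-ring

poly-^ : ∀ {f} k → IsPolynomial f → IsPolynomial (λ x → f x ^ k)
poly-^ zero    _      = poly-const 1ℚ
poly-^ (suc k) f-poly = poly-* f-poly (poly-^ k f-poly)

poly-∘-scale : ∀ {f} c → IsPolynomial f → IsPolynomial (λ x → f (c * x))
poly-∘-scale c (d , f-deg) = d , HasDegree<-∘-scale c f-deg

HasDegree<-+-const : ∀ {d f} c → HasDegree< (suc d) f → HasDegree< (suc d) (λ x → f x + c)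
HasDegree<-+-const c (a , f′ , f′-deg , f≡) =
  a + c , f′ , f′-deg , λ x → trans (cong (_+ c) (f≡ x)) (swap a (x * f′ x) c)
  where
  swap : ∀ a b c → a + b + c ≡ a + c + b
  swap = solve-∀ ℚ-ring

factor-theorem : ∀ {d f} ρ → HasDegree< (suc d) f → f ρ ≡ 0ℚ →
                 ∃ λ g → HasDegree< d g × (∀ x → f x ≡ (x - ρ) * g x)
factor-theorem {zero} {f} ρ (a , g , g≡0 , f≡) fρ≡0 =
  (λ _ → 0ℚ) , (λ _ → refl) , λ x → trans (f≗a x) (trans a≡0 (sym (*-zeroʳ (x - ρ))))
  where
  f≗a : ∀ x → f x ≡ a
  f≗a x = trans (f≡ x) (trans (cong (λ y → a + x * y) (g≡0 x)) (trans (cong (a +_) (*-zeroʳ x)) (+-identityʳ a)))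
  a≡0 : a ≡ 0ℚ
  a≡0 = trans (sym (f≗a ρ)) fρ≡0
factor-theorem {suc d} {f} ρ (a , g , g-deg , f≡) fρ≡0
  with factor-theorem ρ (HasDegree<-+-const (- g ρ) g-deg) (+-inverseʳ (g ρ))
... | h , h-deg , g-gρ≡ =
  (λ x → g ρ + x * h x) , (g ρ , h , h-deg , λ _ → refl) , λ x → begin
    f x                                      ≡⟨ f≡ x ⟩
    a + x * g x                              ≡⟨ cong₂ (λ b y → b + x * y) a≡ (g≡ x) ⟩
    - (ρ * g ρ) + x * (g ρ + (x - ρ) * h x)  ≡⟨ regroup ρ x (g ρ) (h x) ⟩
    (x - ρ) * (g ρ + x * h x)                ∎
  where
  open ≡-Reasoning
  g≡ : ∀ x → g x ≡ g ρ + (x - ρ) * h x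
  g≡ x = trans (split (g x) (g ρ)) (cong (g ρ +_) (g-gρ≡ x))
    where
    split : ∀ y z → y ≡ z + (y - z)
    split = solve-∀ ℚ-ring
  a≡ : a ≡ - (ρ * g ρ)
  a≡ = inverseˡ-unique a (ρ * g ρ) (trans (sym (f≡ ρ)) fρ≡0)
  regroup : ∀ ρ x c h → - (ρ * c) + x * (c + (x - ρ) * h) ≡ (x - ρ) * (c + x * h)
  regroup = solve-∀ ℚ-ring

HasDegree<-roots : ∀ {d f} (p : ℕ → ℚ) → Injective _≡_ _≡_ p → (∀ n → f (p n) ≡ 0ℚ) →
                   HasDegree< d f → ∀ x → f x ≡ 0ℚ
HasDegree<-roots {zero}      p p-inj roots f≡0   = f≡0
HasDegree<-roots {suc d} {f} p p-inj roots f-deg x with factor-theorem (p 0) f-deg (roots 0)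
... | g , g-deg , f≡ = begin
  f x                 ≡⟨ f≡ x ⟩
  (x - p 0) * g x     ≡⟨ cong ((x - p 0) *_) (g≡0 x) ⟩
  (x - p 0) * 0ℚ      ≡⟨ *-zeroʳ (x - p 0) ⟩
  0ℚ                  ∎
  where
  open ≡-Reasoning
  g-roots : ∀ n → g (p (suc n)) ≡ 0ℚ
  g-roots n = *-≡0-cancelˡ (λ eq → ℕ.1+n≢0 (p-inj (x-y≡0⇒x≡y _ _ eq))) (trans (sym (f≡ (p (suc n)))) (roots (suc n)))
  g≡0 : ∀ x → g x ≡ 0ℚ
  g≡0 = HasDegree<-roots (λ n → p (suc n)) (λ eq → ℕ.suc-injective (p-inj eq)) g-roots g-deg

polynomial-identity : ∀ {f g} → IsPolynomial f → IsPolynomial g → (p : ℕ → ℚ) → Injective _≡_ _≡_ p →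
                      (∀ n → f (p n) ≡ g (p n)) → f ≗ g
polynomial-identity {f} {g} f-poly g-poly p p-inj agree x =
  x-y≡0⇒x≡y (f x) (g x) (HasDegree<-roots p p-inj roots (proj₂ (poly-+ f-poly (poly-neg g-poly))) x)
  where
  roots : ∀ n → f (p n) - g (p n) ≡ 0ℚ
  roots n = trans (cong (_- g (p n)) (agree n)) (+-inverseʳ (g (p n)))

-- Rationals greater than one

increasing⇒< : ∀ {f : ℕ → ℚ} → (∀ n → f n < f (suc n)) → ∀ {i j} → i ℕ.< j → f i < f j
increasing⇒< {f} inc {i} {suc j} (s≤s i≤j) with ℕ.m≤n⇒m<n∨m≡n i≤j
... | inj₁ i<j  = <-trans (increasing⇒< inc i<j) (inc j)
... | inj₂ refl = inc i

increasing⇒injective : ∀ {f : ℕ → ℚ} → (∀ n → f n < f (suc n)) → Injective _≡_ _≡_ f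
increasing⇒injective {f} inc {i} {j} fi≡fj with ℕ.<-cmp i j
... | tri< i<j _ _ = ⊥-elim (<⇒≢ (increasing⇒< inc i<j) fi≡fj)
... | tri≈ _ i≡j _ = i≡j
... | tri> _ _ j<i = ⊥-elim (<⇒≢ (increasing⇒< inc j<i) (sym fi≡fj))

1<⇒≢-1 : ∀ {a} → 1ℚ < a → a ≢ - 1ℚ
1<⇒≢-1 1<a a≡-1 = <-asym (subst (1ℚ <_) a≡-1 1<a) (*<* ℤ.-<+)

pos⇒≢0 : ∀ {p} → Positive p → p ≢ 0ℚ
pos⇒≢0 {p} p>0 p≡0 = <⇒≢ (positive⁻¹ p {{p>0}}) (sym p≡0)

1<⇒pos : ∀ {a} → 1ℚ < a → Positive a
1<⇒pos 1<a = positive (<-trans (positive⁻¹ 1ℚ) 1<a)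

1<⇒≢1 : ∀ {a} → 1ℚ < a → a ≢ 1ℚ
1<⇒≢1 1<a a≡1 = <⇒≢ 1<a (sym a≡1)

1<-* : ∀ {a b} → 1ℚ < a → 1ℚ < b → 1ℚ < a * b
1<-* {a} {b} 1<a 1<b =
  <-trans 1<a (subst (_< a * b) (*-identityʳ a) (*-monoʳ-<-pos a {{1<⇒pos 1<a}} 1<b))

^-pos : ∀ a k → Positive a → Positive (a ^ k)
^-pos a zero    _   = _
^-pos a (suc k) a>0 = pos*pos⇒pos a {{a>0}} (a ^ k) {{^-pos a k a>0}}

^-increasing : ∀ {a} → 1ℚ < a → ∀ n → a ^ n < a ^ suc n
^-increasing {a} 1<a n =
  subst (_< a ^ suc n) (*-identityˡ (a ^ n)) (*-monoˡ-<-pos (a ^ n) {{^-pos a n (1<⇒pos 1<a)}} 1<a)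

1<^suc : ∀ {a} → 1ℚ < a → ∀ n → 1ℚ < a ^ suc n
1<^suc {a} 1<a n = increasing⇒< {a ^_} (^-increasing 1<a) {0} {suc n} (s≤s z≤n)

^suc-injective : ∀ {a} → 1ℚ < a → Injective _≡_ _≡_ (λ n → a ^ suc n)
^suc-injective 1<a = increasing⇒injective (λ n → ^-increasing 1<a (suc n))

Π₀-pos : ∀ N (f : ℕ → ℚ) → (∀ i → Positive (f i)) → Positive (Π₀ N f)
Π₀-pos zero    f f>0 = f>0 0
Π₀-pos (suc N) f f>0 = pos*pos⇒pos (Π₀ N f) {{Π₀-pos N f f>0}} (f (suc N)) {{f>0 (suc N)}}

1+pos : ∀ a → Positive a → Positive (1ℚ + a)
1+pos a a>0 = pos+pos⇒pos 1ℚ a {{a>0}}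

1<2 : 1ℚ < 1ℚ + 1ℚ
1<2 = *<* (ℤ.+<+ (s≤s (s≤s z≤n)))

sample : ℕ → ℚ
sample n = (1ℚ + 1ℚ) ^ suc n

1<sample : ∀ n → 1ℚ < sample n
1<sample = 1<^suc 1<2

sample-injective : Injective _≡_ _≡_ sample
sample-injective = ^suc-injective 1<2

sample²-injective : Injective _≡_ _≡_ (λ n → sample n * sample n)
sample²-injective {i} {j} eq =
  ^suc-injective (1<-* 1<2 1<2) (trans (^-distribʳ-* 2ℚ 2ℚ (suc i)) (trans eq (sym (^-distribʳ-* 2ℚ 2ℚ (suc j)))))
  where
  2ℚ : ℚ
  2ℚ = 1ℚ + 1ℚ

-- Coefficient lists

ι-canonical : ∀ i → ι i ≡ mkℚ i 0 (Coprime.sym (Coprime.1-coprimeTo ℤ.∣ i ∣))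
ι-canonical (ℤ.+ n)  = normalize-coprime (Coprime.sym (Coprime.1-coprimeTo n))
ι-canonical -[1+ n ] = cong -_ (normalize-coprime (Coprime.sym (Coprime.1-coprimeTo (suc n))))

ι-* : ∀ a b → ι (a ℤ.* b) ≡ ι a * ι b
ι-* a b rewrite ι-canonical a | ι-canonical b = refl

ι-injective : Injective _≡_ _≡_ ι
ι-injective {a} {b} ιa≡ιb rewrite ι-canonical a | ι-canonical b = cong ↥_ ιa≡ιb

eval-polynomial : ∀ P → IsPolynomial (eval P)
eval-polynomial []      = poly-const 0ℚ
eval-polynomial (a ∷ P) = poly-+ (poly-const (ι a)) (poly-x* (eval-polynomial P))

eval-twice : ∀ P x → eval (twice P) x ≡ (1ℚ + 1ℚ) * eval P x
eval-twice []      x = sym (*-zeroʳ (1ℚ + 1ℚ))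
eval-twice (a ∷ P) x =
  trans (cong₂ (λ b e → b + x * e) (ι-* (ℤ.+ 2) a) (eval-twice P x)) (factor (ι a) x (eval P x))
  where
  factor : ∀ a x e → (1ℚ + 1ℚ) * a + x * ((1ℚ + 1ℚ) * e) ≡ (1ℚ + 1ℚ) * (a + x * e)
  factor = solve-∀ ℚ-ring

eval-split : ∀ P x → eval P x ≡ ι (coeff P 0) + x * eval (drop 1 P) x
eval-split []      x = sym (trans (+-identityˡ _) (*-zeroʳ x))
eval-split (a ∷ P) x = refl

coeff-drop : ∀ P d → coeff P (suc d) ≡ coeff (drop 1 P) d
coeff-drop []      d = refl
coeff-drop (a ∷ P) d = refl

eval-≗⇒coeff₀≡ : ∀ P R → eval P ≗ eval R → ι (coeff P 0) ≡ ι (coeff R 0)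
eval-≗⇒coeff₀≡ P R P≗R = begin
  ι (coeff P 0)                              ≡⟨ sym (at-0 P) ⟩
  ι (coeff P 0) + 0ℚ * eval (drop 1 P) 0ℚ    ≡⟨ sym (eval-split P 0ℚ) ⟩
  eval P 0ℚ                                  ≡⟨ P≗R 0ℚ ⟩
  eval R 0ℚ                                  ≡⟨ eval-split R 0ℚ ⟩
  ι (coeff R 0) + 0ℚ * eval (drop 1 R) 0ℚ    ≡⟨ at-0 R ⟩
  ι (coeff R 0)                              ∎
  where
  open ≡-Reasoning
  at-0 : ∀ P → ι (coeff P 0) + 0ℚ * eval (drop 1 P) 0ℚ ≡ ι (coeff P 0)
  at-0 P = trans (cong (ι (coeff P 0) +_) (*-zeroˡ (eval (drop 1 P) 0ℚ))) (+-identityʳ _)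

eval-≗⇒≈ₚ : ∀ P R → eval P ≗ eval R → P ≈ₚ R
eval-≗⇒≈ₚ P R P≗R zero    = ι-injective (eval-≗⇒coeff₀≡ P R P≗R)
eval-≗⇒≈ₚ P R P≗R (suc d) =
  trans (coeff-drop P d) (trans (eval-≗⇒≈ₚ (drop 1 P) (drop 1 R) tails-agree d) (sym (coeff-drop R d)))
  where
  tails-agree-at-sample : ∀ n → eval (drop 1 P) (sample n) ≡ eval (drop 1 R) (sample n)
  tails-agree-at-sample n = *-cancelˡ-≢0 {x} (pos⇒≢0 (1<⇒pos (1<sample n)))
    (+-cancelˡ (ι (coeff P 0)) _ _ (begin
      ι (coeff P 0) + x * eval (drop 1 P) x   ≡⟨ sym (eval-split P x) ⟩
      eval P x                                ≡⟨ P≗R x ⟩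
      eval R x                                ≡⟨ eval-split R x ⟩
      ι (coeff R 0) + x * eval (drop 1 R) x   ≡⟨ cong (_+ x * eval (drop 1 R) x) (sym (eval-≗⇒coeff₀≡ P R P≗R)) ⟩
      ι (coeff P 0) + x * eval (drop 1 R) x   ∎))
    where
    open ≡-Reasoning
    x : ℚ
    x = sample n
  tails-agree : eval (drop 1 P) ≗ eval (drop 1 R)
  tails-agree = polynomial-identity (eval-polynomial (drop 1 P)) (eval-polynomial (drop 1 R)) sample
    sample-injective tails-agree-at-sample

≈ₚ-from-samples : ∀ P R (p : ℕ → ℚ) → Injective _≡_ _≡_ p → (∀ n → eval P (p n) ≡ eval R (p n)) → P ≈ₚ R
≈ₚ-from-samples P R p p-inj agree =
  eval-≗⇒≈ₚ P R (polynomial-identity (eval-polynomial P) (eval-polynomial R) p p-inj agree)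

module FunctionalEquation {q : ℚ} (1<q : 1ℚ < q) where

  w r : ℚ
  w = 1ℚ ÷′ (1ℚ - q)
  r = 1ℚ ÷′ q

  X Y u : ℚ → ℚ
  X x = (1ℚ - x) * w
  Y x = (1ℚ - q * x) * w
  u x = X x * Y x

  [1-q]w≡1 : (1ℚ - q) * w ≡ 1ℚ
  [1-q]w≡1 = *-1÷′-inverse {1ℚ - q} (1-≢0 (1<⇒≢1 1<q))

  qr≡1 : q * r ≡ 1ℚ
  qr≡1 = *-1÷′-inverse {q} (pos⇒≢0 (1<⇒pos 1<q))

  qint≡X : ∀ n → qint q n ≡ X (q ^ n)
  qint≡X n = ÷′≡*1÷′ (1ℚ - q ^ n) (1ℚ - q)

  qint-product≡u : ∀ n → qint q n * qint q (suc n) ≡ u (q ^ n)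
  qint-product≡u n = cong₂ _*_ (qint≡X n) (qint≡X (suc n))

  Y-at-powers-≢0 : ∀ n → Y (q ^ n) ≢ 0ℚ
  Y-at-powers-≢0 n = *-≢0 (1-≢0 (1<⇒≢1 (1<^suc 1<q n))) (inverse-≢0 {1ℚ - q} [1-q]w≡1)

  Y-at-1 : Y 1ℚ ≡ 1ℚ
  Y-at-1 = trans (cong (λ z → (1ℚ - z) * w) (*-identityʳ q)) [1-q]w≡1

  Y-at-r : Y r ≡ 0ℚ
  Y-at-r = trans (cong (λ z → (1ℚ - z) * w) qr≡1) (trans (cong (_* w) (+-inverseʳ 1ℚ)) (*-zeroˡ w))

  X-at-r : X r ≡ - r
  X-at-r = begin
    (1ℚ - r) * w              ≡⟨ cong (λ z → (z - r) * w) (sym qr≡1) ⟩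
    (q * r - r) * w           ≡⟨ regroup q r w ⟩
    - r * ((1ℚ - q) * w)      ≡⟨ cong (- r *_) [1-q]w≡1 ⟩
    - r * 1ℚ                  ≡⟨ *-identityʳ (- r) ⟩
    - r                       ∎
    where
    open ≡-Reasoning
    regroup : ∀ q r w → (q * r - r) * w ≡ - r * ((1ℚ - q) * w)
    regroup = solve-∀ ℚ-ring

  u-at-1 : u 1ℚ ≡ 0ℚ
  u-at-1 = trans (cong (λ z → z * w * Y 1ℚ) (+-inverseʳ 1ℚ)) (trans (cong (_* Y 1ℚ) (*-zeroˡ w)) (*-zeroˡ (Y 1ℚ)))

  u-at-r : u r ≡ 0ℚ
  u-at-r = trans (cong (X r *_) Y-at-r) (*-zeroʳ (X r))

  X-polynomial : IsPolynomial X
  X-polynomial = poly-* (poly-+ (poly-const 1ℚ) (poly-neg poly-id)) (poly-const w)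

  Y-polynomial : IsPolynomial Y
  Y-polynomial = poly-* (poly-+ (poly-const 1ℚ) (poly-neg (poly-* (poly-const q) poly-id))) (poly-const w)

  S : (ℕ → ℚ) → ℕ → ℚ → ℚ
  S c j x = horner (λ i → (- x) ^ i * c i) (u x) j

  S-polynomial : ∀ c j → IsPolynomial (S c j)
  S-polynomial c zero    = poly-const 0ℚ
  S-polynomial c (suc j) =
    poly-+ (poly-* (poly-^ j (poly-neg poly-id)) (poly-const (c j)))
           (poly-* (poly-* X-polynomial Y-polynomial) (S-polynomial c j))

  S-at-root-of-u : ∀ c j {x} → u x ≡ 0ℚ → S c (suc j) x ≡ (- x) ^ j * c j
  S-at-root-of-u c j {x} ux≡0 =
    trans (cong (λ z → (- x) ^ j * c j + z * S c j x) ux≡0)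
          (trans (cong ((- x) ^ j * c j +_) (*-zeroˡ (S c j x))) (+-identityʳ _))

  q^k[-r]^k≡sgn : ∀ k → q ^ k * (- r) ^ k ≡ sgn k
  q^k[-r]^k≡sgn k = trans (sym (neg-*-^ q r k)) (cong (λ z → (- z) ^ k) qr≡1)

  functional-equation⇒top-coefficients :
    ∀ (c : ℕ → ℚ) j N κ {α β : ℚ → ℚ} → IsPolynomial α → IsPolynomial β →
    (∀ x → α x + β x ≡ κ * Y x) → α r ≡ 1ℚ → q * β r * X r ≡ 1ℚ →
    (∀ n → α (q ^ suc n) * S c (suc (suc j)) (q * q ^ suc n)
             + q ^ suc j * β (q ^ suc n) * S c (suc (suc j)) (q ^ suc n)
           ≡ Y (q ^ suc n) ^ suc (suc N)) →
    κ * c (suc j) ≡ (1ℚ + 1ℚ) * c j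
  functional-equation⇒top-coefficients c j N κ {α} {β} α-poly β-poly α+β≡κY α[r]≡1 qβ[r]X[r]≡1 equation =
    sym (x-y≡0⇒x≡y _ _ (*-≡0-cancelˡ {sgn j} (inverse-≢0 {sgn j} (sgn-self-inverse j)) (trans (sym Φ[r]) (Φ≡0 r))))
    where
    open ≡-Reasoning
    c₁ c₀ Q : ℚ
    c₁ = c (suc j)
    c₀ = c j
    Q = q ^ suc j
    B : ℚ → ℚ
    B = S c (suc j)

    Φ : ℚ → ℚ
    Φ x = κ * c₁ * (- (q * x)) ^ suc j + α x * Y (q * x) * B (q * x) + Q * β x * X x * B x - Y x ^ suc N

    Φ-polynomial : IsPolynomial Φ
    Φ-polynomial =
      poly-+ (poly-+ (poly-+
        (poly-* (poly-const (κ * c₁)) (poly-^ (suc j) (poly-neg (poly-* (poly-const q) poly-id))))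
        (poly-* (poly-* α-poly (poly-∘-scale q Y-polynomial)) (poly-∘-scale q (S-polynomial c (suc j)))))
        (poly-* (poly-* (poly-* (poly-const Q) β-poly) X-polynomial) (S-polynomial c (suc j))))
        (poly-neg (poly-^ (suc N) Y-polynomial))

    Y*Φ : ∀ x → Y x * Φ x ≡ α x * S c (suc (suc j)) (q * x) + Q * β x * S c (suc (suc j)) x - Y x ^ suc (suc N)
    Y*Φ x = begin
      Y x * Φ x
        ≡⟨ distrib (Y x) κ c₁ P (α x) (Y (q * x)) (B (q * x)) Q (β x) (X x) (B x) (Y x ^ suc N) ⟩
      κ * Y x * P * c₁ + Y x * rest - E
        ≡⟨ cong₂ (λ a z → a * z * c₁ + Y x * rest - E) (sym (α+β≡κY x)) P≡Qm ⟩
      (α x + β x) * (Q * m) * c₁ + Y x * rest - E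
        ≡⟨ collect (α x) (β x) Q m c₁ (Y x) (Y (q * x)) (B (q * x)) (X x) (B x) E ⟩
      α x * (Q * m * c₁ + Y x * Y (q * x) * B (q * x)) + Q * β x * (m * c₁ + X x * Y x * B x) - E
        ≡⟨ cong (λ z → α x * (z * c₁ + Y x * Y (q * x) * B (q * x)) + Q * β x * (m * c₁ + X x * Y x * B x) - E)
                (sym P≡Qm) ⟩
      α x * S c (suc (suc j)) (q * x) + Q * β x * S c (suc (suc j)) x - E
        ∎
      where
      P m rest E : ℚ
      P = (- (q * x)) ^ suc j
      m = (- x) ^ suc j
      rest = α x * Y (q * x) * B (q * x) + Q * β x * X x * B x
      E = Y x ^ suc (suc N)
      P≡Qm : P ≡ Q * m
      P≡Qm = neg-*-^ q x (suc j)
      distrib : ∀ y κ c P α y′ b′ Q β ξ b E →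
                y * (κ * c * P + α * y′ * b′ + Q * β * ξ * b - E)
                ≡ κ * y * P * c + y * (α * y′ * b′ + Q * β * ξ * b) - y * E
      distrib = solve-∀ ℚ-ring
      collect : ∀ α β Q m c y y′ b′ ξ b E →
                (α + β) * (Q * m) * c + y * (α * y′ * b′ + Q * β * ξ * b) - E
                ≡ α * (Q * m * c + y * y′ * b′) + Q * β * (m * c + ξ * y * b) - E
      collect = solve-∀ ℚ-ring

    Φ-at-powers : ∀ n → Φ (q ^ suc n) ≡ 0ℚ
    Φ-at-powers n = *-≡0-cancelˡ (Y-at-powers-≢0 (suc n)) (begin
      Y x * Φ x                                        ≡⟨ Y*Φ x ⟩
      (α x * S c (suc (suc j)) (q * x) + Q * β x * S c (suc (suc j)) x) - E
                                                       ≡⟨ cong (_- E) (equation n) ⟩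
      E - E                                            ≡⟨ +-inverseʳ E ⟩
      0ℚ                                               ∎)
      where
      x E : ℚ
      x = q ^ suc n
      E = Y x ^ suc (suc N)

    Φ≡0 : ∀ x → Φ x ≡ 0ℚ
    Φ≡0 = polynomial-identity Φ-polynomial (poly-const 0ℚ) (λ n → q ^ suc n) (^suc-injective 1<q) Φ-at-powers

    α-term-at-r : α r * Y (q * r) * B (q * r) ≡ 1ℚ * 1ℚ * (sgn j * c₀)
    α-term-at-r = trans (cong₂ (λ a z → a * Y z * B z) α[r]≡1 qr≡1)
                        (cong₂ (λ y b → 1ℚ * y * b) Y-at-1 (S-at-root-of-u c j {1ℚ} u-at-1))

    β-term-at-r : Q * β r * X r * B r ≡ 1ℚ * sgn j * c₀
    β-term-at-r = begin
      Q * β r * X r * B r                           ≡⟨ cong (Q * β r * X r *_) (S-at-root-of-u c j {r} u-at-r) ⟩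
      Q * β r * X r * ((- r) ^ j * c₀)              ≡⟨ regroup q (q ^ j) (β r) (X r) ((- r) ^ j) c₀ ⟩
      q * β r * X r * (q ^ j * (- r) ^ j) * c₀      ≡⟨ cong₂ (λ a s → a * s * c₀) qβ[r]X[r]≡1 (q^k[-r]^k≡sgn j) ⟩
      1ℚ * sgn j * c₀                               ∎
      where
      regroup : ∀ q Q β ξ ρ c → q * Q * β * ξ * (ρ * c) ≡ q * β * ξ * (Q * ρ) * c
      regroup = solve-∀ ℚ-ring

    Φ[r] : Φ r ≡ sgn j * ((1ℚ + 1ℚ) * c₀ - κ * c₁)
    Φ[r] = begin
      Φ r
        ≡⟨ cong₂ (λ z e → κ * c₁ * (- z) ^ suc j + α r * Y (q * r) * B (q * r) + Q * β r * X r * B r - e ^ suc N)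
                 qr≡1 Y-at-r ⟩
      κ * c₁ * sgn (suc j) + α r * Y (q * r) * B (q * r) + Q * β r * X r * B r - 0ℚ ^ suc N
        ≡⟨ cong₂ _-_ (cong₂ (λ b b′ → κ * c₁ * sgn (suc j) + b + b′) α-term-at-r β-term-at-r) (0^suc N) ⟩
      κ * c₁ * ((- 1ℚ) * sgn j) + 1ℚ * 1ℚ * (sgn j * c₀) + 1ℚ * sgn j * c₀ - 0ℚ
        ≡⟨ simplify κ c₁ (sgn j) c₀ ⟩
      sgn j * ((1ℚ + 1ℚ) * c₀ - κ * c₁)
        ∎
      where
      simplify : ∀ κ c₁ s c₀ → κ * c₁ * ((- 1ℚ) * s) + 1ℚ * 1ℚ * (s * c₀) + 1ℚ * s * c₀ - 0ℚ
                               ≡ s * ((1ℚ + 1ℚ) * c₀ - κ * c₁)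
      simplify = solve-∀ ℚ-ring

-- The families G and H

2*[2+j]≡4+[j+j] : ∀ j → 2 ℕ.* (2 ℕ.+ j) ≡ 4 ℕ.+ (j ℕ.+ j)
2*[2+j]≡4+[j+j] = ℕSolver.solve-∀

2*[2+j]≡1+[2*[1+j]+1] : ∀ j → 2 ℕ.* (2 ℕ.+ j) ≡ 1 ℕ.+ (2 ℕ.* (1 ℕ.+ j) ℕ.+ 1)
2*[2+j]≡1+[2*[1+j]+1] = ℕSolver.solve-∀

module G-coefficients (G : ℕ → ℕ → Poly) (isG : IsGFamily G) (j : ℕ) {t : ℚ} (1<t : 1ℚ < t) where

  q : ℚ
  q = t * t
  m : ℕ
  m = suc (suc j)
  open FunctionalEquation (1<-* 1<t 1<t)

  factor : ℕ → ℚ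
  factor i = 1ℚ + q ^ (m ∸ i)

  c : ℕ → ℚ
  c i = eval (G m i) q ÷′ Π₀ i factor

  T-as-S : ∀ n → 1 ≤ n → T (2 ℕ.* m) n t ≡ u (q ^ n) * S c m (q ^ n)
  T-as-S n 1≤n = begin
    T (2 ℕ.* m) n t                                   ≡⟨ isG m (s≤s z≤n) n 1≤n t (1<⇒≢1 1<t) (1<⇒≢-1 1<t) ⟩
    Σ₁ m (λ k → a (m ∸ k) * U ^ k)                    ≡⟨ Σ₁-horner-shifted m a U ⟩
    U * horner a U m                                  ≡⟨ cong (λ U → U * horner a U m) (qint-product≡u n) ⟩
    u (q ^ n) * S c m (q ^ n)                         ∎
    where
    open ≡-Reasoning
    a : ℕ → ℚ
    a i = (- (q ^ n)) ^ i * c i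
    U : ℚ
    U = qint q n * qint q (suc n)

  functional-equation : ∀ n → let x = q ^ suc n in
    Y (q * x) * S c m (q * x) + q ^ suc j * (q * X x) * S c m x ≡ Y x ^ suc (suc (suc (j ℕ.+ j)))
  functional-equation n = *-cancelˡ-≢0 (Y-at-powers-≢0 (suc n)) (begin
    Y x * (Y (q * x) * S c m (q * x) + q ^ suc j * (q * X x) * S c m x)
      ≡⟨ regroup (Y x) (Y (q * x)) (S c m (q * x)) q (q ^ suc j) (X x) (S c m x) ⟩
    u (q * x) * S c m (q * x) + q ^ m * (u x * S c m x)
      ≡⟨ cong₂ (λ s s′ → s + q ^ m * s′) (sym (T-as-S (suc (suc n)) (s≤s z≤n))) (sym (T-as-S (suc n) (s≤s z≤n))) ⟩
    T (2 ℕ.* m) (suc (suc n)) t + q ^ m * T (2 ℕ.* m) (suc n) t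
      ≡⟨ cong (λ z → T (2 ℕ.* m) (suc (suc n)) t + z * T (2 ℕ.* m) (suc n) t) (sym (^-even t m)) ⟩
    T (2 ℕ.* m) (suc (suc n)) t + t ^ (2 ℕ.* m) * T (2 ℕ.* m) (suc n) t
      ≡⟨ T-recurrence (2 ℕ.* m) (suc n) t ⟩
    qint q (suc (suc n)) ^ (2 ℕ.* m)
      ≡⟨ cong₂ _^_ (qint≡X (suc (suc n))) (2*[2+j]≡4+[j+j] j) ⟩
    Y x * Y x ^ suc (suc (suc (j ℕ.+ j)))
      ∎)
    where
    open ≡-Reasoning
    x : ℚ
    x = q ^ suc n
    regroup : ∀ y y′ s′ q Q ξ s → y * (y′ * s′ + Q * (q * ξ) * s) ≡ y * y′ * s′ + q * Q * (ξ * y * s)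
    regroup = solve-∀ ℚ-ring

  Y[qx]+qX[x]≡[1+q]Y[x] : ∀ x → Y (q * x) + q * X x ≡ (1ℚ + q) * Y x
  Y[qx]+qX[x]≡[1+q]Y[x] x = regroup q x w
    where
    regroup : ∀ q x w → (1ℚ - q * (q * x)) * w + q * ((1ℚ - x) * w) ≡ (1ℚ + q) * ((1ℚ - q * x) * w)
    regroup = solve-∀ ℚ-ring

  Y[qr]≡1 : Y (q * r) ≡ 1ℚ
  Y[qr]≡1 = trans (cong Y qr≡1) Y-at-1

  q[qX[r]]X[r]≡1 : q * (q * X r) * X r ≡ 1ℚ
  q[qX[r]]X[r]≡1 = begin
    q * (q * X r) * X r      ≡⟨ cong (λ ξ → q * (q * ξ) * ξ) X-at-r ⟩
    q * (q * - r) * - r      ≡⟨ regroup q r ⟩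
    (q * r) * (q * r)        ≡⟨ cong₂ _*_ qr≡1 qr≡1 ⟩
    1ℚ * 1ℚ                  ≡⟨ *-identityˡ 1ℚ ⟩
    1ℚ                       ∎
    where
    open ≡-Reasoning
    regroup : ∀ q r → q * (q * - r) * - r ≡ (q * r) * (q * r)
    regroup = solve-∀ ℚ-ring

  top-coefficients-relation : (1ℚ + q) * c (suc j) ≡ (1ℚ + 1ℚ) * c j
  top-coefficients-relation =
    functional-equation⇒top-coefficients c j (suc (j ℕ.+ j)) (1ℚ + q)
      (poly-∘-scale q Y-polynomial) (poly-* (poly-const q) X-polynomial)
      Y[qx]+qX[x]≡[1+q]Y[x] Y[qr]≡1 q[qX[r]]X[r]≡1 functional-equation

  q-pos : Positive q
  q-pos = 1<⇒pos (1<-* 1<t 1<t)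

  factor-pos : ∀ i → Positive (factor i)
  factor-pos i = 1+pos (q ^ (m ∸ i)) (^-pos q (m ∸ i) q-pos)

  last-factor : Π₀ (suc j) factor ≡ Π₀ j factor * (1ℚ + q)
  last-factor = trans (cong (λ e → Π₀ j factor * (1ℚ + q ^ e)) (ℕ.m+n∸n≡m 1 j))
                      (cong (λ z → Π₀ j factor * (1ℚ + z)) (*-identityʳ q))

  top-coefficients : eval (G m (suc j)) q ≡ (1ℚ + 1ℚ) * eval (G m j) q
  top-coefficients = cancel-denominators (1ℚ + 1ℚ) (Π₀ j factor) (1ℚ + q)
    (pos⇒≢0 (Π₀-pos j factor factor-pos)) (pos⇒≢0 (1+pos q q-pos)) last-factor top-coefficients-relation

module H-coefficients (H : ℕ → ℕ → Poly) (isH : IsHFamily H) (j : ℕ) {t : ℚ} (1<t : 1ℚ < t) where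

  q : ℚ
  q = t * t
  m M : ℕ
  m = suc (suc j)
  M = 2 ℕ.* m ∸ 1
  open FunctionalEquation (1<-* 1<t 1<t)

  factor : ℕ → ℚ
  factor i = 1ℚ + t ^ (2 ℕ.* (m ∸ i) ∸ 1)

  denominator : ℕ → ℚ
  denominator i = (1ℚ + t) ^ (i ℕ.+ 1) * Π₀ i factor

  c : ℕ → ℚ
  c i = eval (H m i) t ÷′ denominator i

  v : ℚ
  v = 1ℚ ÷′ (1ℚ - t)

  A : ℚ → ℚ
  A x = (1ℚ - t * x) * v

  [1-t]v≡1 : (1ℚ - t) * v ≡ 1ℚ
  [1-t]v≡1 = *-1÷′-inverse {1ℚ - t} (1-≢0 (1<⇒≢1 1<t))

  homogeneous : ℕ → ℚ
  homogeneous n = sgn (m ℕ.+ n) * (eval (H m (m ∸ 1)) t * t ^ (M ℕ.* n)) ÷′ ((1ℚ + t) ^ m * Π₀ (m ∸ 1) factor)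

  T-as-S : ∀ n → 1 ≤ n → T M n t ≡ homogeneous n + A (q ^ n) * S c m (q ^ n)
  T-as-S n 1≤n = begin
    T M n t
      ≡⟨ isH m (s≤s z≤n) n 1≤n t (1<⇒≢1 1<t) (1<⇒≢-1 1<t) ⟩
    homogeneous n + (1ℚ - t ^ (2 ℕ.* n ℕ.+ 1)) ÷′ (1ℚ - t)
                    * Σ₁ m (λ k → (- x) ^ (m ∸ k) * eval (H m (m ∸ k)) t * U ^ (k ∸ 1) ÷′ denominator (m ∸ k))
      ≡⟨ cong₂ (λ a s → homogeneous n + a * s) prefactor≡A
               (Σ₁-cong m (λ k _ _ →
                 move-denominator ((- x) ^ (m ∸ k)) (eval (H m (m ∸ k)) t) (U ^ (k ∸ 1)) (denominator (m ∸ k)))) ⟩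
    homogeneous n + A x * Σ₁ m (λ k → a (m ∸ k) * U ^ (k ∸ 1))
      ≡⟨ cong (λ s → homogeneous n + A x * s) (Σ₁-horner m a U) ⟩
    homogeneous n + A x * horner a U m
      ≡⟨ cong (λ U → homogeneous n + A x * horner a U m) (qint-product≡u n) ⟩
    homogeneous n + A x * S c m x
      ∎
    where
    open ≡-Reasoning
    x U : ℚ
    x = q ^ n
    U = qint q n * qint q (suc n)
    a : ℕ → ℚ
    a i = (- x) ^ i * c i
    prefactor≡A : (1ℚ - t ^ (2 ℕ.* n ℕ.+ 1)) ÷′ (1ℚ - t) ≡ A x
    prefactor≡A = trans (÷′≡*1÷′ _ (1ℚ - t)) (cong (λ z → (1ℚ - z) * v) (^-odd t n))
    move-denominator : ∀ p h V D → p * h * V ÷′ D ≡ p * (h ÷′ D) * V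
    move-denominator p h V D =
      trans (÷′≡*1÷′ (p * h * V) D) (trans (regroup p h V (1ℚ ÷′ D)) (cong (λ z → p * z * V) (sym (÷′≡*1÷′ h D))))
      where
      regroup : ∀ p h V i → p * h * V * i ≡ p * (h * i) * V
      regroup = solve-∀ ℚ-ring

  functional-equation : ∀ n → let x = q ^ suc n in
    A (q * x) * S c m (q * x) + q ^ suc j * (t * A x) * S c m x ≡ Y x ^ suc (suc (suc (j ℕ.+ j)))
  functional-equation n = begin
    A (q * x) * S c m (q * x) + q ^ suc j * (t * A x) * S c m x
      ≡⟨ regroup (A (q * x) * S c m (q * x)) (q ^ suc j) t (A x) (S c m x) ⟩
    A (q * x) * S c m (q * x) + t * q ^ suc j * (A x * S c m x)
      ≡⟨ cong (λ z → A (q * x) * S c m (q * x) + z * (A x * S c m x)) (sym t^M≡) ⟩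
    A (q * x) * S c m (q * x) + t ^ M * (A x * S c m x)
      ≡⟨ drop-homogeneous (homogeneous (suc (suc n))) (homogeneous (suc n)) _ _ (t ^ M) _
           (trans (cong₂ (λ T₁ T₀ → T₁ + t ^ M * T₀)
                         (sym (T-as-S (suc (suc n)) (s≤s z≤n))) (sym (T-as-S (suc n) (s≤s z≤n))))
                  (T-recurrence M (suc n) t))
           (alternating-geometric-recurrence t M (eval (H m (m ∸ 1)) t) ((1ℚ + t) ^ m * Π₀ (m ∸ 1) factor) m (suc n)) ⟩
    qint q (suc (suc n)) ^ M
      ≡⟨ cong₂ _^_ (qint≡X (suc (suc n))) (cong ℕ.pred (2*[2+j]≡4+[j+j] j)) ⟩
    Y x ^ suc (suc (suc (j ℕ.+ j)))
      ∎
    where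
    open ≡-Reasoning
    x : ℚ
    x = q ^ suc n
    t^M≡ : t ^ M ≡ t * q ^ suc j
    t^M≡ = trans (cong (t ^_) (cong ℕ.pred (2*[2+j]≡1+[2*[1+j]+1] j))) (^-odd t (suc j))
    regroup : ∀ F Q t a s → F + Q * (t * a) * s ≡ F + t * Q * (a * s)
    regroup = solve-∀ ℚ-ring

  v≡[1+t]w : v ≡ (1ℚ + t) * w
  v≡[1+t]w = begin
    v                                  ≡⟨ sym (*-identityʳ v) ⟩
    v * 1ℚ                             ≡⟨ cong (v *_) (sym [1-q]w≡1) ⟩
    v * ((1ℚ - t * t) * w)             ≡⟨ regroup t v w ⟩
    (1ℚ + t) * w * ((1ℚ - t) * v)      ≡⟨ cong ((1ℚ + t) * w *_) [1-t]v≡1 ⟩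
    (1ℚ + t) * w * 1ℚ                  ≡⟨ *-identityʳ _ ⟩
    (1ℚ + t) * w                       ∎
    where
    open ≡-Reasoning
    regroup : ∀ t v w → v * ((1ℚ - t * t) * w) ≡ (1ℚ + t) * w * ((1ℚ - t) * v)
    regroup = solve-∀ ℚ-ring

  A[qx]+tA[x]≡[1+t]²Y[x] : ∀ x → A (q * x) + t * A x ≡ (1ℚ + t) * (1ℚ + t) * Y x
  A[qx]+tA[x]≡[1+t]²Y[x] x = begin
    (1ℚ - t * (t * t * x)) * v + t * ((1ℚ - t * x) * v)   ≡⟨ factorise t x v ⟩
    (1ℚ + t) * (1ℚ - t * t * x) * v                       ≡⟨ cong ((1ℚ + t) * (1ℚ - t * t * x) *_) v≡[1+t]w ⟩
    (1ℚ + t) * (1ℚ - t * t * x) * ((1ℚ + t) * w)          ≡⟨ regroup t x w ⟩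
    (1ℚ + t) * (1ℚ + t) * ((1ℚ - t * t * x) * w)          ∎
    where
    open ≡-Reasoning
    factorise : ∀ t x v → (1ℚ - t * (t * t * x)) * v + t * ((1ℚ - t * x) * v) ≡ (1ℚ + t) * (1ℚ - t * t * x) * v
    factorise = solve-∀ ℚ-ring
    regroup : ∀ t x w → (1ℚ + t) * (1ℚ - t * t * x) * ((1ℚ + t) * w) ≡ (1ℚ + t) * (1ℚ + t) * ((1ℚ - t * t * x) * w)
    regroup = solve-∀ ℚ-ring

  A[qr]≡1 : A (q * r) ≡ 1ℚ
  A[qr]≡1 = trans (cong A qr≡1) (trans (cong (λ z → (1ℚ - z) * v) (*-identityʳ t)) [1-t]v≡1)

  q[tA[r]]X[r]≡1 : q * (t * A r) * X r ≡ 1ℚ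
  q[tA[r]]X[r]≡1 = begin
    q * (t * A r) * X r                          ≡⟨ cong (q * (t * A r) *_) X-at-r ⟩
    t * t * (t * ((1ℚ - t * r) * v)) * - r       ≡⟨ regroup t r v ⟩
    (q * r) * v * (q * r - t)                    ≡⟨ cong (λ ρ → ρ * v * (ρ - t)) qr≡1 ⟩
    1ℚ * v * (1ℚ - t)                            ≡⟨ swap v t ⟩
    (1ℚ - t) * v                                 ≡⟨ [1-t]v≡1 ⟩
    1ℚ                                           ∎
    where
    open ≡-Reasoning
    regroup : ∀ t r v → t * t * (t * ((1ℚ - t * r) * v)) * - r ≡ (t * t * r) * v * (t * t * r - t)
    regroup = solve-∀ ℚ-ring
    swap : ∀ v t → 1ℚ * v * (1ℚ - t) ≡ (1ℚ - t) * v
    swap = solve-∀ ℚ-ring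

  A-polynomial : IsPolynomial A
  A-polynomial = poly-* (poly-+ (poly-const 1ℚ) (poly-neg (poly-* (poly-const t) poly-id))) (poly-const v)

  top-coefficients-relation : (1ℚ + t) * (1ℚ + t) * c (suc j) ≡ (1ℚ + 1ℚ) * c j
  top-coefficients-relation =
    functional-equation⇒top-coefficients c j (suc (j ℕ.+ j)) ((1ℚ + t) * (1ℚ + t))
      (poly-∘-scale q A-polynomial) (poly-* (poly-const t) A-polynomial)
      A[qx]+tA[x]≡[1+t]²Y[x] A[qr]≡1 q[tA[r]]X[r]≡1 functional-equation

  t-pos : Positive t
  t-pos = 1<⇒pos 1<t

  1+t-pos : Positive (1ℚ + t)
  1+t-pos = 1+pos t t-pos

  denominator-pos : Positive (denominator j)
  denominator-pos = pos*pos⇒pos ((1ℚ + t) ^ (j ℕ.+ 1)) {{^-pos (1ℚ + t) (j ℕ.+ 1) 1+t-pos}} (Π₀ j factor)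
    {{Π₀-pos j factor (λ i → 1+pos (t ^ (2 ℕ.* (m ∸ i) ∸ 1)) (^-pos t (2 ℕ.* (m ∸ i) ∸ 1) t-pos))}}

  last-denominator : denominator (suc j) ≡ denominator j * ((1ℚ + t) * (1ℚ + t))
  last-denominator = begin
    (1ℚ + t) * (1ℚ + t) ^ (j ℕ.+ 1) * (Π₀ j factor * factor (suc j))
      ≡⟨ cong (λ e → (1ℚ + t) * (1ℚ + t) ^ (j ℕ.+ 1) * (Π₀ j factor * (1ℚ + t ^ (2 ℕ.* e ∸ 1))))
              (ℕ.m+n∸n≡m 1 j) ⟩
    (1ℚ + t) * (1ℚ + t) ^ (j ℕ.+ 1) * (Π₀ j factor * (1ℚ + t * 1ℚ))
      ≡⟨ cong (λ z → (1ℚ + t) * (1ℚ + t) ^ (j ℕ.+ 1) * (Π₀ j factor * (1ℚ + z))) (*-identityʳ t) ⟩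
    (1ℚ + t) * (1ℚ + t) ^ (j ℕ.+ 1) * (Π₀ j factor * (1ℚ + t))
      ≡⟨ regroup (1ℚ + t) ((1ℚ + t) ^ (j ℕ.+ 1)) (Π₀ j factor) ⟩
    (1ℚ + t) ^ (j ℕ.+ 1) * Π₀ j factor * ((1ℚ + t) * (1ℚ + t))
      ∎
    where
    open ≡-Reasoning
    regroup : ∀ a b P → a * b * (P * a) ≡ b * P * (a * a)
    regroup = solve-∀ ℚ-ring

  top-coefficients : eval (H m (suc j)) t ≡ (1ℚ + 1ℚ) * eval (H m j) t
  top-coefficients = cancel-denominators (1ℚ + 1ℚ) (denominator j) ((1ℚ + t) * (1ℚ + t))
    (pos⇒≢0 denominator-pos) (pos⇒≢0 (pos*pos⇒pos (1ℚ + t) {{1+t-pos}} (1ℚ + t) {{1+t-pos}}))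
    last-denominator top-coefficients-relation

corollary3p10 : (G H : ℕ → ℕ → Poly) → IsGFamily G → IsHFamily H →
    ∀ m → 2 ≤ m →
      (G m (m ∸ 1) ≈ₚ twice (G m (m ∸ 2))) × (H m (m ∸ 1) ≈ₚ twice (H m (m ∸ 2)))
corollary3p10 G H isG isH (suc zero) (s≤s ())
corollary3p10 G H isG isH (suc (suc j)) _ =
  ≈ₚ-from-samples (G m (suc j)) (twice (G m j)) (λ n → sample n * sample n) sample²-injective
    (λ n → trans (G-coefficients.top-coefficients G isG j (1<sample n)) (sym (eval-twice (G m j) _))) ,
  ≈ₚ-from-samples (H m (suc j)) (twice (H m j)) sample sample-injective
    (λ n → trans (H-coefficients.top-coefficients H isH j (1<sample n)) (sym (eval-twice (H m j) _)))
  where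
  m : ℕ
  m = suc (suc j)
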